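{- Two directed graphs $G=(V,E)$ and $G'=(V',E')$ are isomorphic if and only if there exist a skeleton $\sigma=(\mathcal O,R,f)$ over $V$ and a skeleton $\tau=(\mathcal P,Q,g)$ over $V'$ that are companions and satisfy $G=G_\sigma$ and $G'=G_\tau$.
   Context: A directed graph $G=(V,E)$ has finite vertex set $V$ and $E\subseteq V\times V$. A skeleton over a finite set $V$ is a triple $\sigma=(\mathcal O,R,f)$ where $R\subseteq V$, $\mathcal O=\{O_z\mid z\in R\}$ is a family of subsets of $V$ indexed by $R$ with $O_z=O_{z'}$ iff $z=z'$ and $|\mathcal O|\le|V|$, and $f:V\to R$ is a surjection. The graph defined by $\sigma$ is $G_\sigma=(V,E)$ with $E=\{(x,w)\mid x\in V,\ w\in O_{f(x)}\}$. For a family $\mathcal O$, $\mathcal O^\cap$ is the smallest family containing $\mathcal O$ and closed under intersection of two sets. A faithful correspondence between $\mathcal O\subseteq 2^V$ and $\mathcal P\subseteq 2^W$ is a bijection $\eta:\mathcal O^\cap\to\mathcal P^\cap$ with $|X|=|\eta(X)|$ and $\eta(X\cap Y)=\eta(X)\cap\eta(Y)$ for all $X,Y\in\mathcal O^\cap$. Skeletons $\sigma=(\mathcal O,R,f)$ over $V$ and $\tau=(\mathcal P,Q,g)$ over $W$ are companions if there is a bijection $\eta:V\to W$ whose elementwise extension to subsets restricts to a faithful correspondence $\mathcal O^\cap\to\mathcal P^\cap$ and satisfies $\eta(O_{f(x)})=P_{g(\eta(x))}$ for all $x\in V$. -}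

module Defs where

open import Data.Nat using (ℕ; zero; suc)
open import Data.Bool using (Bool; true; false; _∧_; _∨_)
open import Data.Fin using (Fin; zero; suc; _≟_)
open import Data.Fin.Subset using (Subset; _∈_; _∩_; ∣_∣)
open import Data.Vec using (lookup; tabulate)
open import Data.Product using (Σ; ∃; _×_; _,_)
open import Relation.Binary.PropositionalEquality using (_≡_)
open import Relation.Nullary.Decidable using (⌊_⌋)
open import Function.Definitions using (Bijective)

-- A directed graph on the finite vertex set V = Fin n, given by its
-- (decidable) edge relation: (x , w) ∈ E  iff  E x w ≡ true.
Digraph : ℕ → Set
Digraph n = Fin n → Fin n → Bool

_≐_ : ∀ {n} → Digraph n → Digraph n → Set
G ≐ H = ∀ x w → G x w ≡ H x w

Isomorphic : ∀ {n m} → Digraph n → Digraph m → Set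
Isomorphic {n} {m} G G' =
  Σ (Fin n → Fin m) λ η → Bijective _≡_ _≡_ η × (∀ x y → G x y ≡ G' (η x) (η y))

-- R ⊆ V is a subset; 𝒪 = {O z | z ∈ R} (the values of O outside R are
--   irrelevant); z ↦ O z is injective on R (O_z = O_z' iff z = z');
--   f : V → R is a surjection.  |𝒪| ≤ |V| holds automatically since 𝒪
--   is indexed injectively by R ⊆ V.
record Skeleton (n : ℕ) : Set where
  field
    R      : Subset n
    O      : Fin n → Subset n
    O-inj  : ∀ z z' → z ∈ R → z' ∈ R → O z ≡ O z' → z ≡ z'
    f      : Fin n → Fin n
    f∈R    : ∀ x → f x ∈ R
    f-surj : ∀ z → z ∈ R → ∃ λ x → f x ≡ z

open Skeleton public

InFamily : ∀ {n} → Skeleton n → Subset n → Set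
InFamily σ X = ∃ λ z → z ∈ R σ × O σ z ≡ X

data InCap {n : ℕ} (σ : Skeleton n) : Subset n → Set where
  base : ∀ {X} → InFamily σ X → InCap σ X
  meet : ∀ {X Y} → InCap σ X → InCap σ Y → InCap σ (X ∩ Y)

graphOf : ∀ {n} → Skeleton n → Digraph n
graphOf σ x w = lookup (O σ (f σ x)) w

anyFin : ∀ {n} → (Fin n → Bool) → Bool
anyFin {zero}  p = false
anyFin {suc n} p = p zero ∨ anyFin (λ i → p (suc i))

image : ∀ {n m} → (Fin n → Fin m) → Subset n → Subset m
image η X = tabulate λ w → anyFin λ x → lookup X x ∧ ⌊ η x ≟ w ⌋

-- A faithful correspondence 𝒪^∩ → 𝒫^∩ given by a map φ on subsets
-- (restricted to 𝒪^∩): a bijection 𝒪^∩ → 𝒫^∩ preserving cardinality and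
-- binary intersections.
FaithfulCorrespondence : ∀ {n m} → Skeleton n → Skeleton m →
                         (Subset n → Subset m) → Set
FaithfulCorrespondence {n} {m} σ τ φ =
    (∀ X → InCap σ X → InCap τ (φ X))
  × (∀ X Y → InCap σ X → InCap σ Y → φ X ≡ φ Y → X ≡ Y)
  × (∀ Y → InCap τ Y → ∃ λ X → InCap σ X × φ X ≡ Y)
  × (∀ X → InCap σ X → ∣ X ∣ ≡ ∣ φ X ∣)
  × (∀ X Y → InCap σ X → InCap σ Y → φ (X ∩ Y) ≡ φ X ∩ φ Y)

Companions : ∀ {n m} → Skeleton n → Skeleton m → Set
Companions {n} {m} σ τ =
  Σ (Fin n → Fin m) λ η →
      Bijective _≡_ _≡_ η
    × FaithfulCorrespondence σ τ (image η)
    × (∀ x → image η (O σ (f σ x)) ≡ O τ (f τ (η x)))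

-- The proof rests on one observation about the elementwise image of a
-- bijection η : V → W.  Such an image map is injective on subsets,
-- commutes with ∩ and preserves cardinality, so for skeletons σ, τ the
-- only genuinely combinatorial companion condition is the neighbourhood
-- equation  η(O_{f(x)}) = P_{g(η x)}.  Indeed that equation alone makes
-- η map 𝒪 onto 𝒫 (using that f and g are surjective and η is onto),
-- hence 𝒪^∩ onto 𝒫^∩ ("companionsFromNeighbourhoods").
--
-- (⇐) The neighbourhood equation read pointwise at η y says exactly that
--     η preserves and reflects edges.
-- (⇒) Every graph H is defined by its canonical skeleton: O_x is the
--     out-neighbourhood N(x), f picks a fixed representative among the
--     vertices with the same out-neighbourhood, R is the set of
--     representatives.  An isomorphism maps N(x) to N'(η x), which is the
--     neighbourhood equation for the two canonical skeletons.
module Submission where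

open import Defs
open import Data.Nat using (ℕ; suc)
open import Data.Nat.Properties using (+-0-commutativeMonoid)
open import Algebra.Properties.CommutativeMonoid.Sum +-0-commutativeMonoid
  using (sum; sum-permute; sum-cong-≗)
open import Data.Bool using (Bool; true; false; _∧_; if_then_else_)
import Data.Bool as Bool
open import Data.Fin using (Fin; zero; suc; _≟_)
open import Data.Fin.Properties using (any?)
open import Data.Fin.Subset using (Subset; _∈_; _∩_; ∣_∣)
open import Data.Vec using (Vec; []; _∷_; lookup; tabulate)
open import Data.Vec.Properties
  using (≡-dec; []=⇒lookup; lookup⇒[]=; lookup∘tabulate; tabulate∘lookup; tabulate-cong; lookup-zipWith)
open import Data.Product using (Σ; ∃; _×_; _,_; proj₁; proj₂)
open import Data.Empty using (⊥-elim)
open import Function.Bundles using (_⇔_; mk⇔; mk⤖)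
open import Function.Definitions using (Bijective; Injective)
open import Function.Properties.Bijection using (⤖⇒↔)
open import Relation.Nullary using (yes; no)
open import Relation.Nullary.Decidable using (⌊_⌋)
open import Relation.Binary.PropositionalEquality
open ≡-Reasoning

⌊≟⌋-refl : ∀ {k} (a : Fin k) → ⌊ a ≟ a ⌋ ≡ true
⌊≟⌋-refl a with a ≟ a
... | yes _ = refl
... | no a≢a = ⊥-elim (a≢a refl)

⌊≟⌋-sound : ∀ {k} {a b : Fin k} → ⌊ a ≟ b ⌋ ≡ true → a ≡ b
⌊≟⌋-sound {a = a} {b} _ with a ≟ b
⌊≟⌋-sound _ | yes a≡b = a≡b

∧-true : ∀ {a b} → a ∧ b ≡ true → a ≡ true × b ≡ true
∧-true {true} b≡true = refl , b≡true

anyFin-witness : ∀ {k} (p : Fin k → Bool) → anyFin p ≡ true → ∃ λ x → p x ≡ true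
anyFin-witness {suc k} p holds with p zero in p0
... | true = zero , p0
... | false with anyFin-witness (λ i → p (suc i)) holds
...   | x , px = suc x , px

anyFin-intro : ∀ {k} (p : Fin k → Bool) x → p x ≡ true → anyFin p ≡ true
anyFin-intro p zero px rewrite px = refl
anyFin-intro p (suc x) px rewrite anyFin-intro (λ i → p (suc i)) x px
  with p zero
... | true = refl
... | false = refl

vec-ext : ∀ {A : Set} {k} (X Y : Vec A k) → (∀ i → lookup X i ≡ lookup Y i) → X ≡ Y
vec-ext X Y agree = begin
  X                      ≡⟨ tabulate∘lookup X ⟨
  tabulate (lookup X)    ≡⟨ tabulate-cong agree ⟩
  tabulate (lookup Y)    ≡⟨ tabulate∘lookup Y ⟩
  Y                      ∎

image-lookup : ∀ {n m} (η : Fin n → Fin m) → Injective _≡_ _≡_ η →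
               ∀ X y → lookup (image η X) (η y) ≡ lookup X y
image-lookup η inj X y
  rewrite lookup∘tabulate (λ w → anyFin λ x → lookup X x ∧ ⌊ η x ≟ w ⌋) (η y)
  with lookup X y in y∈X
... | true = anyFin-intro _ y (trans (cong (_∧ ⌊ η y ≟ η y ⌋) y∈X) (⌊≟⌋-refl (η y)))
... | false with anyFin (λ x → lookup X x ∧ ⌊ η x ≟ η y ⌋) in hit
...   | false = refl
...   | true with anyFin-witness _ hit
...     | x , px with ∧-true {lookup X x} px
...       | x∈X , ηx≟ηy with inj {x} {y} (⌊≟⌋-sound ηx≟ηy)
...         | refl with trans (sym y∈X) x∈X
...           | ()

module ImageOfBijection {n m : ℕ} (η : Fin n → Fin m) (bij : Bijective _≡_ _≡_ η) where

  η-inj : Injective _≡_ _≡_ η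
  η-inj = proj₁ bij

  preimage : Fin m → Fin n
  preimage w = proj₁ (proj₂ bij w)

  η-preimage : ∀ w → η (preimage w) ≡ w
  η-preimage w = proj₂ (proj₂ bij w) refl

  ext-along : ∀ (A B : Subset m) → (∀ y → lookup A (η y) ≡ lookup B (η y)) → A ≡ B
  ext-along A B agree = vec-ext A B λ w →
    subst (λ w' → lookup A w' ≡ lookup B w') (η-preimage w) (agree (preimage w))

  image-injective : ∀ X Y → image η X ≡ image η Y → X ≡ Y
  image-injective X Y eq = vec-ext X Y λ y → begin
    lookup X y               ≡⟨ image-lookup η η-inj X y ⟨
    lookup (image η X) (η y) ≡⟨ cong (λ Z → lookup Z (η y)) eq ⟩
    lookup (image η Y) (η y) ≡⟨ image-lookup η η-inj Y y ⟩
    lookup Y y               ∎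

  image-∩ : ∀ X Y → image η (X ∩ Y) ≡ image η X ∩ image η Y
  image-∩ X Y = ext-along _ _ λ y → begin
    lookup (image η (X ∩ Y)) (η y)                      ≡⟨ image-lookup η η-inj (X ∩ Y) y ⟩
    lookup (X ∩ Y) y                                    ≡⟨ lookup-zipWith _∧_ y X Y ⟩
    lookup X y ∧ lookup Y y                             ≡⟨ cong₂ _∧_ (image-lookup η η-inj X y)
                                                                     (image-lookup η η-inj Y y) ⟨
    lookup (image η X) (η y) ∧ lookup (image η Y) (η y) ≡⟨ lookup-zipWith _∧_ (η y) (image η X) (image η Y) ⟨
    lookup (image η X ∩ image η Y) (η y)                ∎

  -- Cardinality as a sum of indicator values, so that it can be reindexed
  -- along the permutation η.
  indicator : ∀ {k} → Subset k → Fin k → ℕ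
  indicator X i = if lookup X i then 1 else 0

  ∣∣-sum : ∀ {k} (X : Subset k) → ∣ X ∣ ≡ sum (indicator X)
  ∣∣-sum []          = refl
  ∣∣-sum (true ∷ X)  = cong suc (∣∣-sum X)
  ∣∣-sum (false ∷ X) = ∣∣-sum X

  image-∣∣ : ∀ X → ∣ X ∣ ≡ ∣ image η X ∣
  image-∣∣ X = begin
    ∣ X ∣                                 ≡⟨ ∣∣-sum X ⟩
    sum (indicator X)                     ≡⟨ sum-cong-≗ (λ i → cong (λ b → if b then 1 else 0)
                                                                (image-lookup η η-inj X i)) ⟨
    sum (λ i → indicator (image η X) (η i)) ≡⟨ sum-permute (indicator (image η X)) (⤖⇒↔ (mk⤖ bij)) ⟨
    sum (indicator (image η X))           ≡⟨ ∣∣-sum (image η X) ⟨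
    ∣ image η X ∣                         ∎

NeighbourhoodEquation : ∀ {n m} → Skeleton n → Skeleton m → (Fin n → Fin m) → Set
NeighbourhoodEquation σ τ η = ∀ x → image η (O σ (f σ x)) ≡ O τ (f τ (η x))

companionsFromNeighbourhoods :
  ∀ {n m} (σ : Skeleton n) (τ : Skeleton m) (η : Fin n → Fin m) →
  Bijective _≡_ _≡_ η → NeighbourhoodEquation σ τ η → Companions σ τ
companionsFromNeighbourhoods σ τ η bij nbhd =
  η , bij , (image-InCap , (λ X Y _ _ → image-injective X Y) , InCap-image ,
             (λ X _ → image-∣∣ X) , (λ X Y _ _ → image-∩ X Y)) , nbhd
  where
  open ImageOfBijection η bij

  -- Every member of 𝒪 is O_{f(x)} for some x, and its image is P_{g(η x)}.
  image-InCap : ∀ X → InCap σ X → InCap τ (image η X)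
  image-InCap _ (base (z , z∈R , refl)) with f-surj σ z z∈R
  ... | x , refl = base (f τ (η x) , f∈R τ (η x) , sym (nbhd x))
  image-InCap _ (meet {X} {Y} cX cY) rewrite image-∩ X Y =
    meet (image-InCap X cX) (image-InCap Y cY)

  -- Every member P_{g(x')} of 𝒫 is the image of O_{f(η⁻¹ x')}.
  InCap-image : ∀ Y → InCap τ Y → ∃ λ X → InCap σ X × image η X ≡ Y
  InCap-image _ (base (z , z∈Q , refl)) with f-surj τ z z∈Q
  ... | x' , refl =
    O σ (f σ (preimage x')) , base (f σ (preimage x') , f∈R σ _ , refl) ,
    trans (nbhd (preimage x')) (cong (λ v → O τ (f τ v)) (η-preimage x'))
  InCap-image _ (meet {Y} {Y'} cY cY') with InCap-image Y cY | InCap-image Y' cY'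
  ... | X , cX , refl | X' , cX' , refl = X ∩ X' , meet cX cX' , image-∩ X X'

module Canonical {k : ℕ} (H : Digraph k) where

  N : Fin k → Subset k
  N x = tabulate (H x)

  pick : Subset k → Fin k → Fin k
  pick V d with any? (λ x → ≡-dec Bool._≟_ (N x) V)
  ... | yes (x , _) = x
  ... | no _ = d

  pick-N : ∀ V d → N d ≡ V → N (pick V d) ≡ V
  pick-N V d Nd≡V with any? (λ x → ≡-dec Bool._≟_ (N x) V)
  ... | yes (_ , Nx≡V) = Nx≡V
  ... | no _ = Nd≡V

  pick-default-irrelevant : ∀ V d d' → N d ≡ V → pick V d ≡ pick V d'
  pick-default-irrelevant V d d' Nd≡V with any? (λ x → ≡-dec Bool._≟_ (N x) V)
  ... | yes _ = refl
  ... | no none = ⊥-elim (none (d , Nd≡V))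

  rep : Fin k → Fin k
  rep x = pick (N x) x

  N-rep : ∀ x → N (rep x) ≡ N x
  N-rep x = pick-N (N x) x refl

  rep-respects-N : ∀ x x' → N x ≡ N x' → rep x ≡ rep x'
  rep-respects-N x x' eq =
    trans (cong (λ V → pick V x) eq) (pick-default-irrelevant (N x') x x' eq)

  rep-idempotent : ∀ x → rep (rep x) ≡ rep x
  rep-idempotent x = rep-respects-N (rep x) x (N-rep x)

  Reps : Subset k
  Reps = tabulate (λ z → ⌊ rep z ≟ z ⌋)

  Reps-fixed : ∀ z → z ∈ Reps → rep z ≡ z
  Reps-fixed z z∈Reps = ⌊≟⌋-sound (begin
    ⌊ rep z ≟ z ⌋ ≡⟨ lookup∘tabulate (λ z → ⌊ rep z ≟ z ⌋) z ⟨
    lookup Reps z ≡⟨ []=⇒lookup z∈Reps ⟩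
    true          ∎)

  fixed-Reps : ∀ z → rep z ≡ z → z ∈ Reps
  fixed-Reps z fixed = lookup⇒[]= z Reps (begin
    lookup Reps z ≡⟨ lookup∘tabulate (λ z → ⌊ rep z ≟ z ⌋) z ⟩
    ⌊ rep z ≟ z ⌋ ≡⟨ cong (λ w → ⌊ w ≟ z ⌋) fixed ⟩
    ⌊ z ≟ z ⌋     ≡⟨ ⌊≟⌋-refl z ⟩
    true          ∎)

  skeleton : Skeleton k
  skeleton = record
    { R      = Reps
    ; O      = N
    ; O-inj  = λ z z' z∈R z'∈R eq →
        trans (sym (Reps-fixed z z∈R)) (trans (rep-respects-N z z' eq) (Reps-fixed z' z'∈R))
    ; f      = rep
    ; f∈R    = λ x → fixed-Reps (rep x) (rep-idempotent x)
    ; f-surj = λ z z∈R → z , Reps-fixed z z∈R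
    }

  defines : H ≐ graphOf skeleton
  defines x w = begin
    H x w                 ≡⟨ lookup∘tabulate (H x) w ⟨
    lookup (N x) w        ≡⟨ cong (λ V → lookup V w) (N-rep x) ⟨
    lookup (N (rep x)) w  ∎

isomorphism-neighbourhoods :
  ∀ {n m} (G : Digraph n) (G' : Digraph m) (η : Fin n → Fin m) (bij : Bijective _≡_ _≡_ η) →
  (∀ x y → G x y ≡ G' (η x) (η y)) →
  NeighbourhoodEquation (Canonical.skeleton G) (Canonical.skeleton G') η
isomorphism-neighbourhoods G G' η bij preserves x = begin
  image η (N (rep x))     ≡⟨ cong (image η) (N-rep x) ⟩
  image η (N x)           ≡⟨ ext-along _ _ image-N ⟩
  N' (η x)                ≡⟨ N'-rep (η x) ⟨
  N' (rep' (η x))         ∎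
  where
  open ImageOfBijection η bij
  open Canonical G
  open Canonical G' using () renaming (N to N'; rep to rep'; N-rep to N'-rep)

  image-N : ∀ y → lookup (image η (N x)) (η y) ≡ lookup (N' (η x)) (η y)
  image-N y = begin
    lookup (image η (N x)) (η y) ≡⟨ image-lookup η η-inj (N x) y ⟩
    lookup (N x) y               ≡⟨ lookup∘tabulate (G x) y ⟩
    G x y                        ≡⟨ preserves x y ⟩
    G' (η x) (η y)               ≡⟨ lookup∘tabulate (G' (η x)) (η y) ⟨
    lookup (N' (η x)) (η y)      ∎

theorem3p9 : ∀ {n m} (G : Digraph n) (G' : Digraph m) →
    Isomorphic G G' ⇔
      Σ (Skeleton n) λ σ → Σ (Skeleton m) λ τ →
        Companions σ τ × (G ≐ graphOf σ) × (G' ≐ graphOf τ)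
theorem3p9 G G' = mk⇔ toSkeletons fromSkeletons
  where
  CompanionSkeletons : Set
  CompanionSkeletons = Σ (Skeleton _) λ σ → Σ (Skeleton _) λ τ →
                         Companions σ τ × (G ≐ graphOf σ) × (G' ≐ graphOf τ)

  toSkeletons : Isomorphic G G' → CompanionSkeletons
  toSkeletons (η , bij , preserves) =
    Canonical.skeleton G , Canonical.skeleton G' ,
    companionsFromNeighbourhoods _ _ η bij (isomorphism-neighbourhoods G G' η bij preserves) ,
    Canonical.defines G , Canonical.defines G'

  fromSkeletons : CompanionSkeletons → Isomorphic G G'
  fromSkeletons (σ , τ , (η , bij , _ , nbhd) , G≐σ , G'≐τ) = η , bij , λ x y → begin
    G x y                                  ≡⟨ G≐σ x y ⟩
    lookup (O σ (f σ x)) y                 ≡⟨ image-lookup η (proj₁ bij) (O σ (f σ x)) y ⟨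
    lookup (image η (O σ (f σ x))) (η y)   ≡⟨ cong (λ V → lookup V (η y)) (nbhd x) ⟩
    lookup (O τ (f τ (η x))) (η y)         ≡⟨ G'≐τ (η x) (η y) ⟨
    G' (η x) (η y)                         ∎
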